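{- Let $T$ be a tree with $n\ge 3$ vertices, let $w$ be a vertex of $T$ of degree $m\ge 2$, let $w_1,\dots,w_m$ be the neighbours of $w$, and let $T_1,\dots,T_m$ be the components of $T-w$, with $w_i\in V(T_i)$ regarded as the root of $T_i$. Let $l$ be the number of pendent vertices of $T$, and for each $i$ let $L_i$ be the set of pendent vertices of $T$ lying in $T_i$, $l_i=|L_i|$ (so $l_1+\cdots+l_m=l$), $TW(T_i)=\sum_{\{x,y\}\subseteq L_i} d(x,y)$ and $d'_{T_i}(w_i)=\sum_{x\in L_i} d(w_i,x)$. Then $$TW(T)=\sum_{i=1}^{m}\Big[TW(T_i)+(l-l_i)\,d'_{T_i}(w_i)-l_i^2\Big]+l^2 .$$
   Context: A pendent vertex is a vertex of degree $1$. For a tree $T$, $d(x,y)$ is the distance between $x$ and $y$, and the terminal Wiener index is $TW(T)=\sum d(x,y)$, the sum over all unordered pairs $\{x,y\}$ of distinct pendent vertices of $T$. -}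

module Defs where

open import Data.Nat using (ℕ; zero; suc; _<ᵇ_; _≡ᵇ_)
open import Data.Bool using (Bool; true; false; _∧_; _∨_; not; if_then_else_)
open import Data.Fin using (Fin; toℕ)
open import Data.Fin.Properties using (_≟_)
open import Data.List using (List; []; _∷_; map; length; filterᵇ; allFin)
open import Data.Nat.ListAction using (sum)
open import Data.Bool.ListAction using (any)
open import Data.List.Relation.Unary.Unique.Propositional using (Unique)
open import Data.Unit using (⊤)
open import Data.Product using (_×_)
open import Relation.Nullary using (¬_; does)
open import Relation.Binary.PropositionalEquality using (_≡_)

record Graph (n : ℕ) : Set where
  field
    adj     : Fin n → Fin n → Bool
    symm    : ∀ x y → adj x y ≡ adj y x
    irrefl  : ∀ x → adj x x ≡ false
open Graph public

_==_ : ∀ {n} → Fin n → Fin n → Bool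
x == y = does (x ≟ y)

module _ {n : ℕ} (G : Graph n) where

  data Walk : Fin n → Fin n → Set where
    here : ∀ {x} → Walk x x
    step : ∀ {x y z} → adj G x y ≡ true → Walk y z → Walk x z

  Connected : Set
  Connected = ∀ x y → Walk x y

  AdjChain : List (Fin n) → Set
  AdjChain []           = ⊤
  AdjChain (x ∷ [])     = ⊤
  AdjChain (x ∷ y ∷ vs) = adj G x y ≡ true × AdjChain (y ∷ vs)

  lastOf : Fin n → List (Fin n) → Fin n
  lastOf x []       = x
  lastOf x (y ∷ vs) = lastOf y vs

  Cycle : Fin n → Fin n → Fin n → List (Fin n) → Set
  Cycle v u t vs = Unique (v ∷ u ∷ t ∷ vs)
                 × AdjChain (v ∷ u ∷ t ∷ vs)
                 × adj G (lastOf t vs) v ≡ true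

  Acyclic : Set
  Acyclic = ∀ v u t vs → ¬ Cycle v u t vs

  IsTree : Set
  IsTree = Connected × Acyclic

  neighbours : Fin n → List (Fin n)
  neighbours x = filterᵇ (adj G x) (allFin n)

  deg : Fin n → ℕ
  deg x = length (neighbours x)

  pendent : Fin n → Bool
  pendent x = deg x ≡ᵇ 1

  reachWithin : (Fin n → Fin n → Bool) → ℕ → Fin n → Fin n → Bool
  reachWithin A zero    x y = x == y
  reachWithin A (suc k) x y =
    reachWithin A k x y ∨ any (λ z → A x z ∧ reachWithin A k z y) (allFin n)

  -- least k < b with p k (or b if none)
  leastBelow : (ℕ → Bool) → ℕ → ℕ
  leastBelow p zero    = zero
  leastBelow p (suc b) = if p zero then zero else suc (leastBelow (λ k → p (suc k)) b)

  -- d(x,y): length of a shortest walk from x to y (well defined as the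
  -- least k ≤ n with a walk of length ≤ k, since G is connected)
  dist : Fin n → Fin n → ℕ
  dist x y = leastBelow (λ k → reachWithin (adj G) k x y) n

  -- Component of G - w containing a vertex u (u ≠ w):
  -- the vertices reachable from u by a walk avoiding w.

  adjAvoid : Fin n → Fin n → Fin n → Bool
  adjAvoid w x y = adj G x y ∧ not (x == w) ∧ not (y == w)

  inComponent : (w u x : Fin n) → Bool
  inComponent w u x = not (x == w) ∧ reachWithin (adjAvoid w) n x u

  sumOver : (Fin n → Bool) → (Fin n → ℕ) → ℕ
  sumOver P f = sum (map f (filterᵇ P (allFin n)))

  count : (Fin n → Bool) → ℕ
  count P = length (filterᵇ P (allFin n))

  pairDistSum : (Fin n → Bool) → ℕ
  pairDistSum P = sumOver P (λ x → sumOver (λ y → P y ∧ (toℕ x <ᵇ toℕ y)) (dist x))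

  TW : ℕ
  TW = pairDistSum pendent

  L : (w u : Fin n) → Fin n → Bool
  L w u x = pendent x ∧ inComponent w u x

  TWcomp : (w u : Fin n) → ℕ
  TWcomp w u = pairDistSum (L w u)

  d′ : (w u : Fin n) → ℕ
  d′ w u = sumOver (L w u) (dist u)

open import Data.Integer using (ℤ; +_) renaming (_+_ to _+ℤ_)

sumℤ : List ℤ → ℤ
sumℤ []       = + 0
sumℤ (z ∷ zs) = z +ℤ sumℤ zs

-- Every pendent vertex x of T lies in the branch Tᵢ of exactly one neighbour
-- wᵢ = root x of w, and the path between pendent vertices in different branches
-- runs through w, so their distance is d(wᵢ,x) + 2 + d(wⱼ,y). Summing over ordered
-- pairs, the pairs inside a branch give 2·TW(Tᵢ), while each x ∈ Lᵢ meets the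
-- l − lᵢ pendent vertices outside its branch and contributes (l − lᵢ)(d(wᵢ,x) + 1)
-- twice. Hence TW(T) = Σᵢ [TW(Tᵢ) + (l − lᵢ)(d′(wᵢ) + lᵢ)], and Σᵢ lᵢ = l turns
-- this into the stated formula.

module Submission where

open import Defs
open import Data.Bool using (Bool; true; false; _∧_; not)
open import Data.Bool.ListAction using (any)
open import Data.Bool.Properties using (T-≡)
import Data.Bool.Properties as Bool
open import Data.Empty using (⊥-elim)
open import Data.Fin using (Fin; zero; suc; toℕ)
open import Data.Fin.Properties using (_≟_; toℕ-injective; pigeonhole; <⇒≢; any?)
open import Data.Integer using (ℤ; +_; _+_; _-_; _*_; 0ℤ; 1ℤ)
import Data.Integer.Properties as ℤ
open import Algebra.Properties.Semiring.Sum ℤ.+-*-semiring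
  using (sum-syntax; sum-cong-≗; sum-replicate-zero; ∑-distrib-+; ∑-comm; *-distribˡ-sum; *-distribʳ-sum)
open import Data.Integer.Tactic.RingSolver using (solve-∀)
open import Data.List using (List; []; _∷_; map; length; filterᵇ; allFin; tabulate; lookup)
open import Data.List.Membership.Propositional using (_∈_; lose)
open import Data.List.Membership.Propositional.Properties using (∈-lookup; ∈-allFin)
open import Data.List.Properties using (map-tabulate)
open import Data.List.Relation.Unary.All using (All; []; _∷_)
import Data.List.Relation.Unary.All as All
open import Data.List.Relation.Unary.All.Properties using (¬Any⇒All¬)
open import Data.List.Relation.Unary.AllPairs using ([]; _∷_)
open import Data.List.Relation.Unary.Any using (here; there; satisfied)
open import Data.List.Relation.Unary.Any.Properties using (any⁺; any⁻)
open import Data.List.Relation.Unary.Unique.Propositional using (Unique)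
open import Data.Nat using (ℕ; zero; suc; _<ᵇ_; _≡ᵇ_; _≤_; _<_; _≥_; z≤n; s≤s)
import Data.Nat as ℕ
open import Data.Nat.ListAction using () renaming (sum to sumℕ)
open import Data.Nat.Properties using (<-cmp; _<?_)
import Data.Nat.Properties as ℕₚ
open import Data.Product using (Σ-syntax; ∃; _×_; _,_; proj₁; proj₂)
import Data.Product as Product
open import Function using (_∘_; id)
open import Function.Bundles using (Equivalence)
open import Relation.Binary using (tri<; tri≈; tri>)
open import Relation.Binary.PropositionalEquality
open import Relation.Nullary using (yes; no)
open import Relation.Nullary.Decidable using (dec-true; dec-false)

𝟙 : Bool → ℤ
𝟙 true  = 1ℤ
𝟙 false = 0ℤ

𝟙-∧ : ∀ a b → 𝟙 (a ∧ b) ≡ 𝟙 a * 𝟙 b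
𝟙-∧ true  true  = refl
𝟙-∧ true  false = refl
𝟙-∧ false _     = refl

𝟙-∧-not : ∀ a b → 𝟙 (a ∧ not b) ≡ 𝟙 a - 𝟙 (a ∧ b)
𝟙-∧-not true  true  = refl
𝟙-∧-not true  false = refl
𝟙-∧-not false _     = refl

𝟙*-cong : ∀ a {i j : ℤ} → (a ≡ true → i ≡ j) → 𝟙 a * i ≡ 𝟙 a * j
𝟙*-cong true  i≡j = cong (1ℤ *_) (i≡j refl)
𝟙*-cong false _   = refl

==-refl : ∀ {n} (x : Fin n) → (x == x) ≡ true
==-refl x = dec-true (x ≟ x) refl

==-sym : ∀ {n} (x y : Fin n) → (x == y) ≡ (y == x)
==-sym x y with x ≟ y
... | yes refl = sym (==-refl x)
... | no x≢y   = sym (dec-false (y ≟ x) (x≢y ∘ sym))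

𝟙-≢ : ∀ {n} (x y : Fin n) → 𝟙 (not (x == y)) ≡ 𝟙 (toℕ x <ᵇ toℕ y) + 𝟙 (toℕ y <ᵇ toℕ x)
-- m <ᵇ n is definitionally does (m <? n), so dec-true and dec-false evaluate it.
𝟙-≢ x y with <-cmp (toℕ x) (toℕ y)
... | tri< x<y x≢y y≮x
  rewrite dec-false (x ≟ y) (x≢y ∘ cong toℕ)
        | dec-true  (toℕ x <? toℕ y) x<y
        | dec-false (toℕ y <? toℕ x) y≮x = refl
... | tri≈ x≮y x≡y y≮x
  rewrite dec-true  (x ≟ y) (toℕ-injective x≡y)
        | dec-false (toℕ x <? toℕ y) x≮y
        | dec-false (toℕ y <? toℕ x) y≮x = refl
... | tri> x≮y x≢y y<x
  rewrite dec-false (x ≟ y) (x≢y ∘ cong toℕ)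
        | dec-false (toℕ x <? toℕ y) x≮y
        | dec-true  (toℕ y <? toℕ x) y<x = refl

∑-distrib-- : ∀ {n} (f g : Fin n → ℤ) → ∑[ i < n ] (f i - g i) ≡ ∑[ i < n ] f i - ∑[ i < n ] g i
∑-distrib-- {zero}  f g = refl
∑-distrib-- {suc n} f g = trans
  (cong (_+_ (f zero - g zero)) (∑-distrib-- (f ∘ suc) (g ∘ suc)))
  (interchange (f zero) (g zero) (∑[ i < n ] f (suc i)) (∑[ i < n ] g (suc i)))
  where
  interchange : ∀ a b c d → a - b + (c - d) ≡ a + c - (b + d)
  interchange = solve-∀

∑-select : ∀ {n} (a : Fin n) (f : Fin n → ℤ) → ∑[ u < n ] (𝟙 (a == u) * f u) ≡ f a
∑-select {suc n} zero f = begin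
  1ℤ * f zero + ∑[ i < n ] 0ℤ ≡⟨ cong (_+_ (1ℤ * f zero)) (sum-replicate-zero n) ⟩
  1ℤ * f zero + 0ℤ            ≡⟨ ℤ.+-identityʳ _ ⟩
  1ℤ * f zero                 ≡⟨ ℤ.*-identityˡ _ ⟩
  f zero                      ∎
  where open ≡-Reasoning
∑-select {suc n} (suc a) f = trans (ℤ.+-identityˡ _) (∑-select a (f ∘ suc))

∑*∑≡∑∑ : ∀ {m n} (a : Fin m → ℤ) (f : Fin m → Fin n → ℤ) →
      ∑[ x < m ] (a x * ∑[ y < n ] f x y) ≡ ∑[ x < m ] ∑[ y < n ] (a x * f x y)
∑*∑≡∑∑ a f = sum-cong-≗ (λ x → *-distribˡ-sum (a x) (f x))

∑*∑-distrib-+ : ∀ {m n} (a : Fin m → ℤ) (f g : Fin m → Fin n → ℤ) →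
  ∑[ x < m ] (a x * ∑[ y < n ] (f x y + g x y))
    ≡ ∑[ x < m ] (a x * ∑[ y < n ] f x y) + ∑[ x < m ] (a x * ∑[ y < n ] g x y)
∑*∑-distrib-+ {m} {n} a f g = trans
  (sum-cong-≗ λ x → trans (cong (a x *_) (∑-distrib-+ (f x) (g x)))
                          (ℤ.*-distribˡ-+ (a x) (∑[ y < n ] f x y) (∑[ y < n ] g x y)))
  (∑-distrib-+ (λ x → a x * ∑[ y < n ] f x y) (λ x → a x * ∑[ y < n ] g x y))

∑*∑-transpose : ∀ {n} (a : Fin n → ℤ) (f g : Fin n → Fin n → ℤ) →
  (∀ x y → a x * f x y ≡ a y * g y x) →
  ∑[ x < n ] (a x * ∑[ y < n ] f x y) ≡ ∑[ x < n ] (a x * ∑[ y < n ] g x y)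
∑*∑-transpose {n} a f g af≡ag = begin
  ∑[ x < n ] (a x * ∑[ y < n ] f x y)    ≡⟨ ∑*∑≡∑∑ a f ⟩
  ∑[ x < n ] ∑[ y < n ] (a x * f x y)    ≡⟨ sum-cong-≗ (λ x → sum-cong-≗ (af≡ag x)) ⟩
  ∑[ x < n ] ∑[ y < n ] (a y * g y x)    ≡⟨ ∑-comm (λ x y → a y * g y x) ⟩
  ∑[ y < n ] ∑[ x < n ] (a y * g y x)    ≡⟨ ∑*∑≡∑∑ a g ⟨
  ∑[ y < n ] (a y * ∑[ x < n ] g y x)    ∎
  where open ≡-Reasoning

module _ {n : ℕ} where

  pairSum : (Fin n → Bool) → (Fin n → Fin n → ℤ) → ℤ
  pairSum Q D = ∑[ x < n ] (𝟙 (Q x) * ∑[ y < n ] (𝟙 (Q y ∧ (toℕ x <ᵇ toℕ y)) * D x y))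

  orderedPairSum : (Fin n → Bool) → (Fin n → Fin n → ℤ) → ℤ
  orderedPairSum Q D = ∑[ x < n ] (𝟙 (Q x) * ∑[ y < n ] (𝟙 (Q y ∧ not (x == y)) * D x y))

  orderedPairSum≡2*pairSum : ∀ Q D → (∀ x y → D x y ≡ D y x) → orderedPairSum Q D ≡ + 2 * pairSum Q D
  orderedPairSum≡2*pairSum Q D D-sym = begin
    orderedPairSum Q D
      ≡⟨ sum-cong-≗ (λ x → cong (𝟙 (Q x) *_) (sum-cong-≗ (split-≢ x))) ⟩
    ∑[ x < n ] (𝟙 (Q x) * ∑[ y < n ] (below x y + above x y))
      ≡⟨ ∑*∑-distrib-+ (𝟙 ∘ Q) below above ⟩
    pairSum Q D + ∑[ x < n ] (𝟙 (Q x) * ∑[ y < n ] above x y)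
      ≡⟨ cong (_+_ (pairSum Q D)) (∑*∑-transpose (𝟙 ∘ Q) above below transpose) ⟩
    pairSum Q D + pairSum Q D
      ≡⟨ double (pairSum Q D) ⟩
    + 2 * pairSum Q D
      ∎
    where
    open ≡-Reasoning
    below above : Fin n → Fin n → ℤ
    below x y = 𝟙 (Q y ∧ (toℕ x <ᵇ toℕ y)) * D x y
    above x y = 𝟙 (Q y ∧ (toℕ y <ᵇ toℕ x)) * D x y
    split-≢ : ∀ x y → 𝟙 (Q y ∧ not (x == y)) * D x y ≡ below x y + above x y
    split-≢ x y with Q y
    ... | false = refl
    ... | true  = trans (cong (_* D x y) (𝟙-≢ x y))
                        (ℤ.*-distribʳ-+ (D x y) (𝟙 (toℕ x <ᵇ toℕ y)) (𝟙 (toℕ y <ᵇ toℕ x)))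
    transpose : ∀ x y → 𝟙 (Q x) * above x y ≡ 𝟙 (Q y) * below y x
    transpose x y
      rewrite 𝟙-∧ (Q y) (toℕ y <ᵇ toℕ x) | 𝟙-∧ (Q x) (toℕ y <ᵇ toℕ x) | D-sym x y
      = exchange (𝟙 (Q x)) (𝟙 (Q y)) (𝟙 (toℕ y <ᵇ toℕ x)) (D y x)
      where exchange : ∀ a b c d → a * (b * c * d) ≡ b * (a * c * d)
            exchange = solve-∀
    double : ∀ i → i + i ≡ + 2 * i
    double = solve-∀

-- P marks the pendent vertices, N the neighbours of the hub w, C u the branch of T − w at the neighbour u,
-- root x the neighbour whose branch contains x, and D the distance.
module ClassDecomposition {n : ℕ}
  (P N : Fin n → Bool) (C : Fin n → Fin n → Bool) (root : Fin n → Fin n)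
  (classify : ∀ x u → P x ≡ true → (N u ∧ C u x) ≡ (root x == u))
  (D : Fin n → Fin n → ℤ) (D-sym : ∀ x y → D x y ≡ D y x)
  (D-cross : ∀ x y → P x ≡ true → P y ≡ true → root x ≢ root y →
             D x y ≡ D (root x) x + (+ 2 + D (root y) y))
  where

  open ≡-Reasoning

  Lᵢ : Fin n → Fin n → Bool
  Lᵢ u x = P x ∧ C u x

  l : ℤ
  l = ∑[ x < n ] 𝟙 (P x)

  lᵢ d′ᵢ TWᵢ : Fin n → ℤ
  lᵢ u = ∑[ x < n ] 𝟙 (Lᵢ u x)
  d′ᵢ u = ∑[ x < n ] (𝟙 (Lᵢ u x) * D u x)
  TWᵢ u = pairSum (Lᵢ u) D

  N-root : ∀ {x} → P x ≡ true → N (root x) ≡ true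
  N-root {x} px = Bool.∧-conicalˡ _ _ (trans (classify x (root x) px) (==-refl (root x)))

  C-root : ∀ {x y} → P x ≡ true → P y ≡ true → C (root x) y ≡ (root x == root y)
  C-root {x} {y} px py = begin
    C (root x) y                 ≡⟨ cong (_∧ C (root x) y) (N-root px) ⟨
    N (root x) ∧ C (root x) y    ≡⟨ classify y (root x) py ⟩
    root y == root x             ≡⟨ ==-sym (root y) (root x) ⟩
    root x == root y             ∎

  L-root : ∀ {x} → P x ≡ true → ∀ y → Lᵢ (root x) y ≡ (P y ∧ (root x == root y))
  L-root px y with P y in py
  ... | false = refl
  ... | true  = C-root px py

  𝟙-class : ∀ x u → 𝟙 (N u) * 𝟙 (Lᵢ u x) ≡ 𝟙 (P x) * 𝟙 (root x == u)
  𝟙-class x u with P x in px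
  ... | false = ℤ.*-zeroʳ (𝟙 (N u))
  ... | true  = begin
    𝟙 (N u) * 𝟙 (C u x)   ≡⟨ 𝟙-∧ (N u) (C u x) ⟨
    𝟙 (N u ∧ C u x)       ≡⟨ cong 𝟙 (classify x u px) ⟩
    𝟙 (root x == u)       ≡⟨ ℤ.*-identityˡ _ ⟨
    1ℤ * 𝟙 (root x == u)  ∎

  ∑-by-class : (G : Fin n → Fin n → ℤ) →
    ∑[ x < n ] (𝟙 (P x) * G (root x) x) ≡ ∑[ u < n ] (𝟙 (N u) * ∑[ x < n ] (𝟙 (Lᵢ u x) * G u x))
  ∑-by-class G = sym (begin
    ∑[ u < n ] (𝟙 (N u) * ∑[ x < n ] (𝟙 (Lᵢ u x) * G u x))
      ≡⟨ ∑*∑≡∑∑ (𝟙 ∘ N) (λ u x → 𝟙 (Lᵢ u x) * G u x) ⟩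
    ∑[ u < n ] ∑[ x < n ] (𝟙 (N u) * (𝟙 (Lᵢ u x) * G u x))
      ≡⟨ ∑-comm (λ u x → 𝟙 (N u) * (𝟙 (Lᵢ u x) * G u x)) ⟩
    ∑[ x < n ] ∑[ u < n ] (𝟙 (N u) * (𝟙 (Lᵢ u x) * G u x))
      ≡⟨ sum-cong-≗ (λ x → sum-cong-≗ (λ u → reassociate x u)) ⟩
    ∑[ x < n ] ∑[ u < n ] (𝟙 (P x) * (𝟙 (root x == u) * G u x))
      ≡⟨ ∑*∑≡∑∑ (𝟙 ∘ P) (λ x u → 𝟙 (root x == u) * G u x) ⟨
    ∑[ x < n ] (𝟙 (P x) * ∑[ u < n ] (𝟙 (root x == u) * G u x))
      ≡⟨ sum-cong-≗ (λ x → cong (𝟙 (P x) *_) (∑-select (root x) (λ u → G u x))) ⟩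
    ∑[ x < n ] (𝟙 (P x) * G (root x) x)
      ∎)
    where
    reassociate : ∀ x u → 𝟙 (N u) * (𝟙 (Lᵢ u x) * G u x) ≡ 𝟙 (P x) * (𝟙 (root x == u) * G u x)
    reassociate x u = begin
      𝟙 (N u) * (𝟙 (Lᵢ u x) * G u x)        ≡⟨ ℤ.*-assoc (𝟙 (N u)) _ _ ⟨
      𝟙 (N u) * 𝟙 (Lᵢ u x) * G u x          ≡⟨ cong (_* G u x) (𝟙-class x u) ⟩
      𝟙 (P x) * 𝟙 (root x == u) * G u x     ≡⟨ ℤ.*-assoc (𝟙 (P x)) _ _ ⟩
      𝟙 (P x) * (𝟙 (root x == u) * G u x)   ∎

  l≡∑lᵢ : l ≡ ∑[ u < n ] (𝟙 (N u) * lᵢ u)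
  l≡∑lᵢ = begin
    l
      ≡⟨ sum-cong-≗ (λ x → ℤ.*-identityʳ (𝟙 (P x))) ⟨
    ∑[ x < n ] (𝟙 (P x) * 1ℤ)
      ≡⟨ ∑-by-class (λ _ _ → 1ℤ) ⟩
    ∑[ u < n ] (𝟙 (N u) * ∑[ x < n ] (𝟙 (Lᵢ u x) * 1ℤ))
      ≡⟨ sum-cong-≗ (λ u → cong (𝟙 (N u) *_) (sum-cong-≗ (λ x → ℤ.*-identityʳ (𝟙 (Lᵢ u x))))) ⟩
    ∑[ u < n ] (𝟙 (N u) * lᵢ u)
      ∎

  viaHub : Fin n → Fin n → ℤ
  viaHub x y = D (root x) x + (+ 2 + D (root y) y)

  crossSum : (Fin n → Fin n → ℤ) → ℤ
  crossSum f = ∑[ x < n ] (𝟙 (P x) * ∑[ y < n ] (𝟙 (P y ∧ not (root x == root y)) * f x y))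

  crossSum-+ : (f g : Fin n → Fin n → ℤ) → crossSum (λ x y → f x y + g x y) ≡ crossSum f + crossSum g
  crossSum-+ f g = trans
    (sum-cong-≗ λ x → cong (𝟙 (P x) *_) (sum-cong-≗ λ y →
      ℤ.*-distribˡ-+ (𝟙 (P y ∧ not (root x == root y))) (f x y) (g x y)))
    (∑*∑-distrib-+ (𝟙 ∘ P) (λ x y → 𝟙 (P y ∧ not (root x == root y)) * f x y)
                            (λ x y → 𝟙 (P y ∧ not (root x == root y)) * g x y))

  crossSum-transpose : (f : Fin n → Fin n → ℤ) → crossSum (λ x y → f y x) ≡ crossSum f
  crossSum-transpose f = ∑*∑-transpose (𝟙 ∘ P) _ _ transpose
    where
    transpose : ∀ x y → 𝟙 (P x) * (𝟙 (P y ∧ not (root x == root y)) * f y x)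
                      ≡ 𝟙 (P y) * (𝟙 (P x ∧ not (root y == root x)) * f y x)
    transpose x y
      rewrite ==-sym (root x) (root y)
            | 𝟙-∧ (P y) (not (root y == root x))
            | 𝟙-∧ (P x) (not (root y == root x))
      = exchange (𝟙 (P x)) (𝟙 (P y)) (𝟙 (not (root y == root x))) (f y x)
      where exchange : ∀ a b c d → a * (b * c * d) ≡ b * (a * c * d)
            exchange = solve-∀

  ∑-outside-class : ∀ {x} → P x ≡ true →
    ∑[ y < n ] 𝟙 (P y ∧ not (root x == root y)) ≡ l - lᵢ (root x)
  ∑-outside-class {x} px = begin
    ∑[ y < n ] 𝟙 (P y ∧ not (root x == root y))
      ≡⟨ sum-cong-≗ (λ y → 𝟙-∧-not (P y) (root x == root y)) ⟩
    ∑[ y < n ] (𝟙 (P y) - 𝟙 (P y ∧ (root x == root y)))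
      ≡⟨ ∑-distrib-- (𝟙 ∘ P) (λ y → 𝟙 (P y ∧ (root x == root y))) ⟩
    l - ∑[ y < n ] 𝟙 (P y ∧ (root x == root y))
      ≡⟨ cong (l -_) (sum-cong-≗ (λ y → cong 𝟙 (L-root px y))) ⟨
    l - lᵢ (root x)
      ∎

  crossSum-row : (g : Fin n → ℤ) →
    crossSum (λ x _ → g x) ≡ ∑[ x < n ] (𝟙 (P x) * ((l - lᵢ (root x)) * g x))
  crossSum-row g = sum-cong-≗ λ x → 𝟙*-cong (P x) λ px → begin
    ∑[ y < n ] (𝟙 (P y ∧ not (root x == root y)) * g x)
      ≡⟨ *-distribʳ-sum (g x) (λ y → 𝟙 (P y ∧ not (root x == root y))) ⟨
    ∑[ y < n ] 𝟙 (P y ∧ not (root x == root y)) * g x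
      ≡⟨ cong (_* g x) (∑-outside-class px) ⟩
    (l - lᵢ (root x)) * g x
      ∎

  split-off-diagonal : ∀ {x} → P x ≡ true → ∀ y →
    𝟙 (P y ∧ not (x == y)) * D x y
      ≡ 𝟙 (Lᵢ (root x) y ∧ not (x == y)) * D x y
        + 𝟙 (P y ∧ not (root x == root y)) * viaHub x y
  split-off-diagonal {x} px y with P y in py
  ... | false = refl
  ... | true rewrite C-root px py with root x ≟ root y
  ...   | yes _     = sym (ℤ.+-identityʳ _)
  ...   | no rx≢ry rewrite dec-false (x ≟ y) (rx≢ry ∘ cong root) = begin
    1ℤ * D x y              ≡⟨ ℤ.*-identityˡ (D x y) ⟩
    D x y                   ≡⟨ D-cross x y px py rx≢ry ⟩
    viaHub x y              ≡⟨ ℤ.*-identityˡ (viaHub x y) ⟨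
    1ℤ * viaHub x y         ≡⟨ ℤ.+-identityˡ (1ℤ * viaHub x y) ⟨
    0ℤ + 1ℤ * viaHub x y    ∎

  orderedPairSum-by-classes :
    orderedPairSum P D ≡ ∑[ u < n ] (𝟙 (N u) * orderedPairSum (Lᵢ u) D)
                         + crossSum viaHub
  orderedPairSum-by-classes = begin
    orderedPairSum P D
      ≡⟨ sum-cong-≗ (λ x → 𝟙*-cong (P x) λ px → sum-cong-≗ (split-off-diagonal px)) ⟩
    ∑[ x < n ] (𝟙 (P x) * ∑[ y < n ] (sameClass x y + 𝟙 (P y ∧ not (root x == root y)) * viaHub x y))
      ≡⟨ ∑*∑-distrib-+ (𝟙 ∘ P) sameClass (λ x y → 𝟙 (P y ∧ not (root x == root y)) * viaHub x y) ⟩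
    ∑[ x < n ] (𝟙 (P x) * ∑[ y < n ] sameClass x y) + crossSum viaHub
      ≡⟨ cong (_+ crossSum viaHub) (∑-by-class (λ u x → ∑[ y < n ] (𝟙 (Lᵢ u y ∧ not (x == y)) * D x y))) ⟩
    ∑[ u < n ] (𝟙 (N u) * orderedPairSum (Lᵢ u) D) + crossSum viaHub
      ∎
    where
    sameClass : Fin n → Fin n → ℤ
    sameClass x y = 𝟙 (Lᵢ (root x) y ∧ not (x == y)) * D x y

  ∑-class-scaled : ∀ u k → ∑[ x < n ] (𝟙 (Lᵢ u x) * (k * (D u x + 1ℤ))) ≡ k * (d′ᵢ u + lᵢ u)
  ∑-class-scaled u k = begin
    ∑[ x < n ] (𝟙 (Lᵢ u x) * (k * (D u x + 1ℤ)))
      ≡⟨ sum-cong-≗ (λ x → distribute (𝟙 (Lᵢ u x)) k (D u x)) ⟩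
    ∑[ x < n ] (k * (𝟙 (Lᵢ u x) * D u x + 𝟙 (Lᵢ u x)))
      ≡⟨ *-distribˡ-sum k (λ x → 𝟙 (Lᵢ u x) * D u x + 𝟙 (Lᵢ u x)) ⟨
    k * ∑[ x < n ] (𝟙 (Lᵢ u x) * D u x + 𝟙 (Lᵢ u x))
      ≡⟨ cong (k *_) (∑-distrib-+ (λ x → 𝟙 (Lᵢ u x) * D u x) (λ x → 𝟙 (Lᵢ u x))) ⟩
    k * (d′ᵢ u + lᵢ u)
      ∎
    where distribute : ∀ a k d → a * (k * (d + 1ℤ)) ≡ k * (a * d + a)
          distribute = solve-∀

  crossSum-through-roots :
    crossSum viaHub
      ≡ + 2 * ∑[ u < n ] (𝟙 (N u) * ((l - lᵢ u) * (d′ᵢ u + lᵢ u)))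
  crossSum-through-roots = begin
    crossSum viaHub
      ≡⟨ sum-cong-≗ (λ x → cong (𝟙 (P x) *_) (sum-cong-≗ λ y →
           cong (𝟙 (P y ∧ not (root x == root y)) *_) (regroup (D (root x) x) (D (root y) y)))) ⟩
    crossSum (λ x y → h x + h y)
      ≡⟨ crossSum-+ (λ x _ → h x) (λ _ y → h y) ⟩
    crossSum (λ x _ → h x) + crossSum (λ _ y → h y)
      ≡⟨ cong (_+_ (crossSum (λ x _ → h x))) (crossSum-transpose (λ x _ → h x)) ⟩
    crossSum (λ x _ → h x) + crossSum (λ x _ → h x)
      ≡⟨ double (crossSum (λ x _ → h x)) ⟩
    + 2 * crossSum (λ x _ → h x)
      ≡⟨ cong (+ 2 *_) (trans (crossSum-row h) (∑-by-class (λ u x → (l - lᵢ u) * (D u x + 1ℤ)))) ⟩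
    + 2 * ∑[ u < n ] (𝟙 (N u) * ∑[ x < n ] (𝟙 (Lᵢ u x) * ((l - lᵢ u) * (D u x + 1ℤ))))
      ≡⟨ cong (+ 2 *_) (sum-cong-≗ λ u → cong (𝟙 (N u) *_) (∑-class-scaled u (l - lᵢ u))) ⟩
    + 2 * ∑[ u < n ] (𝟙 (N u) * ((l - lᵢ u) * (d′ᵢ u + lᵢ u)))
      ∎
    where
    h : Fin n → ℤ
    h x = D (root x) x + 1ℤ
    regroup : ∀ a b → a + (+ 2 + b) ≡ (a + 1ℤ) + (b + 1ℤ)
    regroup = solve-∀
    double : ∀ i → i + i ≡ + 2 * i
    double = solve-∀

  regroup-by-classes :
    ∑[ u < n ] (𝟙 (N u) * (+ 2 * TWᵢ u)) + + 2 * ∑[ u < n ] (𝟙 (N u) * ((l - lᵢ u) * (d′ᵢ u + lᵢ u)))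
      ≡ + 2 * (∑[ u < n ] (𝟙 (N u) * (TWᵢ u + (l - lᵢ u) * d′ᵢ u - lᵢ u * lᵢ u)) + l * l)
  regroup-by-classes = begin
    ∑[ u < n ] twice u + + 2 * ∑[ u < n ] cross u
      ≡⟨ cong (_+_ (∑[ u < n ] twice u)) (*-distribˡ-sum (+ 2) cross) ⟩
    ∑[ u < n ] twice u + ∑[ u < n ] (+ 2 * cross u)
      ≡⟨ ∑-distrib-+ twice (λ u → + 2 * cross u) ⟨
    ∑[ u < n ] (twice u + + 2 * cross u)
      ≡⟨ sum-cong-≗ pointwise ⟩
    ∑[ u < n ] (+ 2 * (A u + l * B u))
      ≡⟨ *-distribˡ-sum (+ 2) (λ u → A u + l * B u) ⟨
    + 2 * ∑[ u < n ] (A u + l * B u)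
      ≡⟨ cong (+ 2 *_) (∑-distrib-+ A (λ u → l * B u)) ⟩
    + 2 * (∑[ u < n ] A u + ∑[ u < n ] (l * B u))
      ≡⟨ cong (λ k → + 2 * (∑[ u < n ] A u + k)) (*-distribˡ-sum l B) ⟨
    + 2 * (∑[ u < n ] A u + l * ∑[ u < n ] B u)
      ≡⟨ cong (λ k → + 2 * (∑[ u < n ] A u + l * k)) l≡∑lᵢ ⟨
    + 2 * (∑[ u < n ] A u + l * l)
      ∎
    where
    twice cross A B : Fin n → ℤ
    twice u = 𝟙 (N u) * (+ 2 * TWᵢ u)
    cross u = 𝟙 (N u) * ((l - lᵢ u) * (d′ᵢ u + lᵢ u))
    A u = 𝟙 (N u) * (TWᵢ u + (l - lᵢ u) * d′ᵢ u - lᵢ u * lᵢ u)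
    B u = 𝟙 (N u) * lᵢ u
    pointwise : ∀ u → twice u + + 2 * cross u ≡ + 2 * (A u + l * B u)
    pointwise u = expand (𝟙 (N u)) (TWᵢ u) l (lᵢ u) (d′ᵢ u)
      where expand : ∀ a t l k d → a * (+ 2 * t) + + 2 * (a * ((l - k) * (d + k)))
                                   ≡ + 2 * (a * (t + (l - k) * d - k * k) + l * (a * k))
            expand = solve-∀

  pairSum-by-classes :
    pairSum P D ≡ ∑[ u < n ] (𝟙 (N u) * (TWᵢ u + (l - lᵢ u) * d′ᵢ u - lᵢ u * lᵢ u)) + l * l
  pairSum-by-classes = ℤ.*-cancelˡ-≡ (+ 2) _ _ (begin
    + 2 * pairSum P D
      ≡⟨ orderedPairSum≡2*pairSum P D D-sym ⟨
    orderedPairSum P D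
      ≡⟨ orderedPairSum-by-classes ⟩
    ∑[ u < n ] (𝟙 (N u) * orderedPairSum (Lᵢ u) D) + crossSum viaHub
      ≡⟨ cong₂ _+_ (sum-cong-≗ λ u → cong (𝟙 (N u) *_) (orderedPairSum≡2*pairSum (Lᵢ u) D D-sym))
                   crossSum-through-roots ⟩
    ∑[ u < n ] (𝟙 (N u) * (+ 2 * TWᵢ u)) + + 2 * ∑[ u < n ] (𝟙 (N u) * ((l - lᵢ u) * (d′ᵢ u + lᵢ u)))
      ≡⟨ regroup-by-classes ⟩
    + 2 * (∑[ u < n ] (𝟙 (N u) * (TWᵢ u + (l - lᵢ u) * d′ᵢ u - lᵢ u * lᵢ u)) + l * l)
      ∎)

module _ {A : Set} where

  sumℤ-filterᵇ : (p : A → Bool) (f : A → ℤ) (xs : List A) →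
                 sumℤ (map f (filterᵇ p xs)) ≡ sumℤ (map (λ x → 𝟙 (p x) * f x) xs)
  sumℤ-filterᵇ p f []       = refl
  sumℤ-filterᵇ p f (x ∷ xs) with p x
  ... | true  = cong₂ _+_ (sym (ℤ.*-identityˡ (f x))) (sumℤ-filterᵇ p f xs)
  ... | false = trans (sumℤ-filterᵇ p f xs) (sym (ℤ.+-identityˡ _))

  +-sum : (f : A → ℕ) (xs : List A) → + sumℕ (map f xs) ≡ sumℤ (map (+_ ∘ f) xs)
  +-sum f []       = refl
  +-sum f (x ∷ xs) = trans (ℤ.pos-+ (f x) _) (cong (_+_ (+ f x)) (+-sum f xs))

  +-length : (xs : List A) → + length xs ≡ sumℤ (map (λ _ → 1ℤ) xs)
  +-length []       = refl
  +-length (x ∷ xs) = trans (ℤ.pos-+ 1 (length xs)) (cong (_+_ 1ℤ) (+-length xs))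

sumℤ-tabulate : ∀ {n} (f : Fin n → ℤ) → sumℤ (tabulate f) ≡ ∑[ i < n ] f i
sumℤ-tabulate {zero}  f = refl
sumℤ-tabulate {suc n} f = cong (_+_ (f zero)) (sumℤ-tabulate (f ∘ suc))

sumℤ-allFin : ∀ {n} (f : Fin n → ℤ) → sumℤ (map f (allFin n)) ≡ ∑[ i < n ] f i
sumℤ-allFin f = trans (cong sumℤ (map-tabulate id f)) (sumℤ-tabulate f)

sumℤ-filter-allFin : ∀ {n} (P : Fin n → Bool) (f : Fin n → ℤ) →
  sumℤ (map f (filterᵇ P (allFin n))) ≡ ∑[ x < n ] (𝟙 (P x) * f x)
sumℤ-filter-allFin {n} P f = trans (sumℤ-filterᵇ P f (allFin n)) (sumℤ-allFin (λ x → 𝟙 (P x) * f x))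

module _ {n : ℕ} (G : Graph n) where

  sumOver-∑ : (P : Fin n → Bool) (f : Fin n → ℕ) → + sumOver G P f ≡ ∑[ x < n ] (𝟙 (P x) * + f x)
  sumOver-∑ P f = trans (+-sum f (filterᵇ P (allFin n))) (sumℤ-filter-allFin P (+_ ∘ f))

  count-∑ : (P : Fin n → Bool) → + count G P ≡ ∑[ x < n ] 𝟙 (P x)
  count-∑ P = begin
    + count G P                                   ≡⟨ +-length (filterᵇ P (allFin n)) ⟩
    sumℤ (map (λ _ → 1ℤ) (filterᵇ P (allFin n)))  ≡⟨ sumℤ-filter-allFin P (λ _ → 1ℤ) ⟩
    ∑[ x < n ] (𝟙 (P x) * 1ℤ)                      ≡⟨ sum-cong-≗ (λ x → ℤ.*-identityʳ (𝟙 (P x))) ⟩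
    ∑[ x < n ] 𝟙 (P x)                             ∎
    where open ≡-Reasoning

  pairDistSum-∑ : (P : Fin n → Bool) → + pairDistSum G P ≡ pairSum P (λ x y → + dist G x y)
  pairDistSum-∑ P = trans (sumOver-∑ P _)
    (sum-cong-≗ λ x → cong (𝟙 (P x) *_) (sumOver-∑ (λ y → P y ∧ (toℕ x <ᵇ toℕ y)) (dist G x)))

lookup-injective : ∀ {A : Set} {xs : List A} → Unique xs → ∀ i j → lookup xs i ≡ lookup xs j → i ≡ j
lookup-injective (_ ∷ _)      zero    zero    _  = refl
lookup-injective (x∉xs ∷ _)   zero    (suc j) eq = ⊥-elim (All.lookup x∉xs (∈-lookup j) eq)
lookup-injective (x∉xs ∷ _)   (suc i) zero    eq = ⊥-elim (All.lookup x∉xs (∈-lookup i) (sym eq))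
lookup-injective (_ ∷ unique) (suc i) (suc j) eq = cong suc (lookup-injective unique i j eq)

length-unique≤ : ∀ {n} {xs : List (Fin n)} → Unique xs → length xs ≤ n
length-unique≤ {n} {xs} unique with length xs ℕₚ.≤? n
... | yes len≤n = len≤n
... | no  len≰n with pigeonhole (ℕₚ.≰⇒> len≰n) (lookup xs)
...   | i , j , i<j , eq = ⊥-elim (<⇒≢ i<j (lookup-injective unique i j eq))

infixr 5 _◅_
data WalkIn {n : ℕ} (A : Fin n → Fin n → Bool) : Fin n → Fin n → Set where
  ε   : ∀ {x} → WalkIn A x x
  _◅_ : ∀ {x y z} → A x y ≡ true → WalkIn A y z → WalkIn A x z

module _ {n : ℕ} {A : Fin n → Fin n → Bool} where

  open import Data.List.Membership.DecPropositional (_≟_ {n}) using (_∈?_)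

  steps : ∀ {x y} → WalkIn A x y → ℕ
  steps ε       = 0
  steps (_ ◅ p) = suc (steps p)

  later : ∀ {x y} → WalkIn A x y → List (Fin n)
  later ε                 = []
  later (_◅_ {y = y} _ p) = y ∷ later p

  vertices : ∀ {x y} → WalkIn A x y → List (Fin n)
  vertices {x} p = x ∷ later p

  length-later : ∀ {x y} (p : WalkIn A x y) → length (later p) ≡ steps p
  length-later ε       = refl
  length-later (_ ◅ p) = cong suc (length-later p)

  lastOf-later : (G : Graph n) → ∀ {x y} (p : WalkIn A x y) → lastOf G x (later p) ≡ y
  lastOf-later G ε       = refl
  lastOf-later G (_ ◅ p) = lastOf-later G p

  infixr 5 _◅◅_
  _◅◅_ : ∀ {x y z} → WalkIn A x y → WalkIn A y z → WalkIn A x z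
  ε       ◅◅ q = q
  (e ◅ p) ◅◅ q = e ◅ (p ◅◅ q)

  steps-◅◅ : ∀ {x y z} (p : WalkIn A x y) (q : WalkIn A y z) → steps (p ◅◅ q) ≡ steps p ℕ.+ steps q
  steps-◅◅ ε       q = refl
  steps-◅◅ (_ ◅ p) q = cong suc (steps-◅◅ p q)

  module _ (A-sym : ∀ a b → A a b ≡ true → A b a ≡ true) where

    reverse : ∀ {x y} → WalkIn A x y → WalkIn A y x
    reverse ε       = ε
    reverse (e ◅ p) = reverse p ◅◅ (A-sym _ _ e ◅ ε)

    steps-reverse : ∀ {x y} (p : WalkIn A x y) → steps (reverse p) ≡ steps p
    steps-reverse ε       = refl
    steps-reverse (e ◅ p) = begin
      steps (reverse p ◅◅ (A-sym _ _ e ◅ ε)) ≡⟨ steps-◅◅ (reverse p) _ ⟩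
      steps (reverse p) ℕ.+ 1               ≡⟨ ℕₚ.+-comm (steps (reverse p)) 1 ⟩
      suc (steps (reverse p))               ≡⟨ cong suc (steps-reverse p) ⟩
      suc (steps p)                         ∎
      where open ≡-Reasoning

  adjChain : (G : Graph n) → (∀ a b → A a b ≡ true → adj G a b ≡ true) →
             ∀ {x y} (p : WalkIn A x y) → AdjChain G (vertices p)
  adjChain G A⊆G ε             = _
  adjChain G A⊆G (e ◅ ε)       = A⊆G _ _ e , _
  adjChain G A⊆G (e ◅ e′ ◅ p)  = A⊆G _ _ e , adjChain G A⊆G (e′ ◅ p)

  dropTo : ∀ {v x y} (p : WalkIn A x y) → v ∈ vertices p →
           Σ[ q ∈ WalkIn A v y ] steps q ≤ steps p × (Unique (vertices p) → Unique (vertices q))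
  dropTo p       (here refl) = p , ℕₚ.≤-refl , id
  dropTo (_ ◅ p) (there v∈p) with dropTo p v∈p
  ... | q , q≤p , unique = q , ℕₚ.m≤n⇒m≤1+n q≤p , λ { (_ ∷ u) → unique u }

  toPath : ∀ {x y} (p : WalkIn A x y) → Σ[ q ∈ WalkIn A x y ] steps q ≤ steps p × Unique (vertices q)
  toPath ε = ε , z≤n , [] ∷ []
  toPath (_◅_ {x} e p) with toPath p
  ... | q , q≤p , unique with x ∈? vertices q
  ...   | yes x∈q = let q′ , q′≤q , unique′ = dropTo q x∈q
                    in q′ , ℕₚ.m≤n⇒m≤1+n (ℕₚ.≤-trans q′≤q q≤p) , unique′ unique
  ...   | no  x∉q = e ◅ q , s≤s q≤p , ¬Any⇒All¬ (vertices q) x∉q ∷ unique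

  steps<n : ∀ {x y} (p : WalkIn A x y) → Unique (vertices p) → steps p < n
  steps<n p unique = subst (_≤ n) (cong suc (length-later p)) (length-unique≤ unique)

module _ {n : ℕ} {A B : Fin n → Fin n → Bool} where

  weaken : (∀ a b → A a b ≡ true → B a b ≡ true) →
           ∀ {x y} → WalkIn A x y → WalkIn B x y
  weaken A⊆B ε       = ε
  weaken A⊆B (e ◅ p) = A⊆B _ _ e ◅ weaken A⊆B p

  steps-weaken : (A⊆B : ∀ a b → A a b ≡ true → B a b ≡ true) →
                 ∀ {x y} (p : WalkIn A x y) → steps (weaken A⊆B p) ≡ steps p
  steps-weaken A⊆B ε       = refl
  steps-weaken A⊆B (e ◅ p) = cong suc (steps-weaken A⊆B p)

module _ {A : Set} where

  any-intro : (f : A → Bool) {xs : List A} {z : A} → z ∈ xs → f z ≡ true → any f xs ≡ true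
  any-intro f z∈xs fz = Equivalence.to T-≡ (any⁺ f (lose z∈xs (Equivalence.from T-≡ fz)))

  any-witness : (f : A → Bool) (xs : List A) → any f xs ≡ true → ∃ λ z → f z ≡ true
  any-witness f xs h = Product.map₂ (Equivalence.to T-≡) (satisfied (any⁻ f xs (Equivalence.from T-≡ h)))

module _ {n : ℕ} (G : Graph n) {A : Fin n → Fin n → Bool} where

  reachWithin-complete : ∀ k {x y} (p : WalkIn A x y) → steps p ≤ k → reachWithin G A k x y ≡ true
  reachWithin-complete zero    {x} ε       _ = ==-refl x
  reachWithin-complete (suc k) {x} ε       _ rewrite reachWithin-complete k {x} ε z≤n = refl
  reachWithin-complete (suc k) {x} {y} (_◅_ {y = z} e p) (s≤s p≤k)
    rewrite any-intro (λ z → A x z ∧ reachWithin G A k z y) (∈-allFin z)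
                      (cong₂ _∧_ e (reachWithin-complete k p p≤k))
    = Bool.∨-zeroʳ _

  reachWithin-sound : ∀ k {x y} → reachWithin G A k x y ≡ true → Σ[ p ∈ WalkIn A x y ] steps p ≤ k
  reachWithin-sound zero {x} {y} h with x ≟ y
  ... | yes refl = ε , z≤n
  reachWithin-sound (suc k) {x} {y} h with reachWithin G A k x y in reach-k
  ... | true  = Product.map₂ ℕₚ.m≤n⇒m≤1+n (reachWithin-sound k reach-k)
  ... | false with any-witness (λ z → A x z ∧ reachWithin G A k z y) (allFin n) h
  ...   | z , h′ with reachWithin-sound k (Bool.∧-conicalʳ _ _ h′)
  ...     | p , p≤k = Bool.∧-conicalˡ _ _ h′ ◅ p , s≤s p≤k

module Walks {n : ℕ} (G : Graph n) where

  leastBelow-≤ : (p : ℕ → Bool) (b k : ℕ) → p k ≡ true → leastBelow G p b ≤ k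
  leastBelow-≤ p zero    k       _  = z≤n
  leastBelow-≤ p (suc b) zero    pk rewrite pk = z≤n
  leastBelow-≤ p (suc b) (suc k) pk with p zero
  ... | true  = z≤n
  ... | false = s≤s (leastBelow-≤ (p ∘ suc) b k pk)

  leastBelow-holds : (p : ℕ → Bool) (b k : ℕ) → k < b → p k ≡ true → p (leastBelow G p b) ≡ true
  leastBelow-holds p (suc b) zero    _         pk rewrite pk = pk
  leastBelow-holds p (suc b) (suc k) (s≤s k<b) pk with p zero in p0
  ... | true  = p0
  ... | false = leastBelow-holds (p ∘ suc) b k k<b pk

  adj-sym : ∀ a b → adj G a b ≡ true → adj G b a ≡ true
  adj-sym a b ab = trans (symm G b a) ab

  fromWalk : ∀ {x y} → Walk G x y → WalkIn (adj G) x y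
  fromWalk here       = ε
  fromWalk (step e p) = e ◅ fromWalk p

  dist-≤-steps : ∀ {x y} (p : WalkIn (adj G) x y) → dist G x y ≤ steps p
  dist-≤-steps {x} {y} p = leastBelow-≤ (λ k → reachWithin G (adj G) k x y) n (steps p)
                                        (reachWithin-complete G (steps p) p ℕₚ.≤-refl)

module Distance {n : ℕ} (G : Graph n) (connected : Connected G) where

  open Walks G

  geodesic : ∀ x y → Σ[ p ∈ WalkIn (adj G) x y ] steps p ≤ dist G x y
  geodesic x y =
    let q , _ , unique = toPath (fromWalk (connected x y))
    in reachWithin-sound G (dist G x y)
         (leastBelow-holds (λ k → reachWithin G (adj G) k x y) n (steps q) (steps<n q unique)
           (reachWithin-complete G (steps q) q ℕₚ.≤-refl))

  dist-sym : ∀ x y → dist G x y ≡ dist G y x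
  dist-sym x y = ℕₚ.≤-antisym (dist≤ x y) (dist≤ y x)
    where
    dist≤ : (x y : Fin n) → dist G x y ≤ dist G y x
    dist≤ x y = let p , p≤d = geodesic y x in begin
      dist G x y                 ≤⟨ dist-≤-steps (reverse adj-sym p) ⟩
      steps (reverse adj-sym p)  ≡⟨ steps-reverse adj-sym p ⟩
      steps p                    ≤⟨ p≤d ⟩
      dist G y x                 ∎
      where open ℕₚ.≤-Reasoning

module Hub {n : ℕ} (G : Graph n) (connected : Connected G) (acyclic : Acyclic G) (w : Fin n) where

  open Walks G
  open Distance G connected

  Avoid : Fin n → Fin n → Bool
  Avoid = adjAvoid G w

  ≢w-from-not : ∀ {a} → not (a == w) ≡ true → a ≢ w
  ≢w-from-not {a} h refl with trans (sym (cong not (==-refl a))) h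
  ... | ()

  not-from-≢w : ∀ {a} → a ≢ w → not (a == w) ≡ true
  not-from-≢w {a} a≢w = cong not (dec-false (a ≟ w) a≢w)

  avoid⇒adj : ∀ a b → Avoid a b ≡ true → adj G a b ≡ true
  avoid⇒adj a b h = Bool.∧-conicalˡ _ _ h

  avoid-≢ˡ : ∀ {a b} → Avoid a b ≡ true → a ≢ w
  avoid-≢ˡ {a} {b} h = ≢w-from-not (Bool.∧-conicalˡ _ _ (Bool.∧-conicalʳ (adj G a b) _ h))

  avoid-≢ʳ : ∀ {a b} → Avoid a b ≡ true → b ≢ w
  avoid-≢ʳ {a} {b} h = ≢w-from-not (Bool.∧-conicalʳ (not (a == w)) _ (Bool.∧-conicalʳ (adj G a b) _ h))

  avoid-intro : ∀ {a b} → adj G a b ≡ true → a ≢ w → b ≢ w → Avoid a b ≡ true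
  avoid-intro ab a≢w b≢w = cong₂ _∧_ ab (cong₂ _∧_ (not-from-≢w a≢w) (not-from-≢w b≢w))

  avoid-sym : ∀ a b → Avoid a b ≡ true → Avoid b a ≡ true
  avoid-sym a b h = avoid-intro (adj-sym a b (avoid⇒adj a b h)) (avoid-≢ʳ h) (avoid-≢ˡ h)

  avoiding-end : ∀ {a b} → a ≢ w → WalkIn Avoid a b → b ≢ w
  avoiding-end a≢w ε       = a≢w
  avoiding-end _   (e ◅ p) = avoiding-end (avoid-≢ʳ e) p

  avoiding-vertices : ∀ {a b} → a ≢ w → (p : WalkIn Avoid a b) → All (_≢ w) (vertices p)
  avoiding-vertices a≢w ε       = a≢w ∷ []
  avoiding-vertices a≢w (e ◅ p) = a≢w ∷ avoiding-vertices (avoid-≢ʳ e) p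

  -- A path u ⋯ v in T − w closes up through w into a cycle unless u = v.
  joined-neighbours-≡ : ∀ {u v} → adj G w u ≡ true → adj G w v ≡ true → WalkIn Avoid u v → u ≡ v
  joined-neighbours-≡ {u} {v} wu wv p with u ≟ v
  ... | yes u≡v = u≡v
  ... | no  u≢v with toPath p
  ...   | ε , _ , _ = ⊥-elim (u≢v refl)
  ...   | _◅_ {y = t} e q , _ , unique =
    ⊥-elim (acyclic w u t (later q) (w∉path ∷ unique , (wu , adjChain G avoid⇒adj (e ◅ q)) , closing))
    where
    w∉path : All (w ≢_) (u ∷ t ∷ later q)
    w∉path = All.map (_∘ sym) (avoiding-vertices (avoid-≢ˡ e) (e ◅ q))
    closing : adj G (lastOf G t (later q)) w ≡ true
    closing = subst (λ z → adj G z w ≡ true) (sym (lastOf-later G q)) (adj-sym w v wv)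

  data HubSplit (x y : Fin n) (k : ℕ) : Set where
    avoids : WalkIn Avoid x y → HubSplit x y k
    visits : ∀ {p} (r : WalkIn Avoid x p) → adj G p w ≡ true → (rest : WalkIn (adj G) w y) →
             steps r ℕ.+ suc (steps rest) ≡ k → HubSplit x y k

  splitAtHub : ∀ {x y} → x ≢ w → (q : WalkIn (adj G) x y) → HubSplit x y (steps q)
  splitAtHub x≢w ε = avoids ε
  splitAtHub x≢w (_◅_ {y = z} e q) with z ≟ w
  ... | yes refl = visits ε e q refl
  ... | no  z≢w with splitAtHub z≢w q
  ...   | avoids r             = avoids (avoid-intro e x≢w z≢w ◅ r)
  ...   | visits r e′ rest len = visits (avoid-intro e x≢w z≢w ◅ r) e′ rest (cong suc len)

  component-sound : ∀ {u x} → inComponent G w u x ≡ true → x ≢ w × WalkIn Avoid x u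
  component-sound h =
    ≢w-from-not (Bool.∧-conicalˡ _ _ h) , proj₁ (reachWithin-sound G n (Bool.∧-conicalʳ _ _ h))

  component-complete : ∀ {u x} → x ≢ w → WalkIn Avoid x u → inComponent G w u x ≡ true
  component-complete x≢w r =
    let q , _ , unique = toPath r
    in cong₂ _∧_ (not-from-≢w x≢w) (reachWithin-complete G n q (ℕₚ.<⇒≤ (steps<n q unique)))

  attached : Fin n → Fin n → Bool
  attached u x = adj G w u ∧ inComponent G w u x

  attached-exists : ∀ {x} → x ≢ w → ∃ λ u → attached u x ≡ true
  attached-exists {x} x≢w with splitAtHub x≢w (fromWalk (connected x w))
  ... | avoids r           = ⊥-elim (avoiding-end x≢w r refl)
  ... | visits {p} r e _ _ = p , cong₂ _∧_ (adj-sym p w e) (component-complete x≢w r)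

  attached-unique : ∀ {x u v} → attached u x ≡ true → attached v x ≡ true → u ≡ v
  attached-unique hu hv =
    joined-neighbours-≡ (Bool.∧-conicalˡ _ _ hu) (Bool.∧-conicalˡ _ _ hv)
      (reverse avoid-sym (walk hu) ◅◅ walk hv)
    where
    walk : ∀ {x u} → attached u x ≡ true → WalkIn Avoid x u
    walk {u = u} h = proj₂ (component-sound (Bool.∧-conicalʳ (adj G w u) _ h))

  -- The value at x = w is junk: w lies in no component of T − w.
  root : Fin n → Fin n
  root x with any? (λ u → attached u x Bool.≟ true)
  ... | yes (u , _) = u
  ... | no  _       = w

  root-attached : ∀ {x} → x ≢ w → attached (root x) x ≡ true
  root-attached {x} x≢w with any? (λ u → attached u x Bool.≟ true)
  ... | yes (_ , h) = h
  ... | no  ∄u      = ⊥-elim (∄u (attached-exists x≢w))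

  attached≡root== : ∀ {x} → x ≢ w → ∀ u → attached u x ≡ (root x == u)
  attached≡root== {x} x≢w u with root x ≟ u
  ... | yes refl = root-attached x≢w
  ... | no  rx≢u with attached u x in h
  ...   | true  = ⊥-elim (rx≢u (attached-unique (root-attached x≢w) h))
  ...   | false = refl

  root-adj : ∀ {x} → x ≢ w → adj G w (root x) ≡ true
  root-adj {x} x≢w = Bool.∧-conicalˡ _ _ (root-attached x≢w)

  root-walk : ∀ {x} → x ≢ w → WalkIn Avoid x (root x)
  root-walk {x} x≢w =
    proj₂ (component-sound (Bool.∧-conicalʳ (adj G w (root x)) _ (root-attached x≢w)))

  dist-root-≤ : ∀ {x p} → x ≢ w → (r : WalkIn Avoid x p) → adj G p w ≡ true →
                dist G (root x) x ≤ steps r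
  dist-root-≤ {x} {p} x≢w r pw = begin
    dist G (root x) x           ≡⟨ cong (λ v → dist G v x) root≡p ⟩
    dist G p x                  ≤⟨ dist-≤-steps (reverse adj-sym r′) ⟩
    steps (reverse adj-sym r′)  ≡⟨ steps-reverse adj-sym r′ ⟩
    steps r′                    ≡⟨ steps-weaken avoid⇒adj r ⟩
    steps r                     ∎
    where
    open ℕₚ.≤-Reasoning
    r′ : WalkIn (adj G) x p
    r′ = weaken avoid⇒adj r
    root≡p : root x ≡ p
    root≡p = attached-unique (root-attached x≢w) (cong₂ _∧_ (adj-sym p w pw) (component-complete x≢w r))

  dist-root-< : ∀ {x} → x ≢ w → (q : WalkIn (adj G) x w) → dist G (root x) x < steps q
  dist-root-< {x} x≢w q with splitAtHub x≢w q
  ... | avoids r            = ⊥-elim (avoiding-end x≢w r refl)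
  ... | visits r e rest len = begin-strict
    dist G (root x) x             ≤⟨ dist-root-≤ x≢w r e ⟩
    steps r                       <⟨ ℕₚ.m<m+n (steps r) (s≤s z≤n) ⟩
    steps r ℕ.+ suc (steps rest)  ≡⟨ len ⟩
    steps q                       ∎
    where open ℕₚ.≤-Reasoning

  dist-through-hub : ∀ {x y} → x ≢ w → y ≢ w → root x ≢ root y →
                     dist G x y ≡ dist G (root x) x ℕ.+ (2 ℕ.+ dist G (root y) y)
  dist-through-hub {x} {y} x≢w y≢w rx≢ry = ℕₚ.≤-antisym upper lower
    where
    open ℕₚ.≤-Reasoning
    upper : dist G x y ≤ dist G (root x) x ℕ.+ (2 ℕ.+ dist G (root y) y)
    upper =
      let px , px≤ = geodesic (root x) x
          py , py≤ = geodesic (root y) y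
          x→rx     = reverse adj-sym px
          x→rx≤    = subst (_≤ dist G (root x) x) (sym (steps-reverse adj-sym px)) px≤
          x→y      = x→rx ◅◅ adj-sym _ _ (root-adj x≢w) ◅ root-adj y≢w ◅ py
      in begin
      dist G x y                                       ≤⟨ dist-≤-steps x→y ⟩
      steps x→y                                        ≡⟨ steps-◅◅ x→rx _ ⟩
      steps x→rx ℕ.+ (2 ℕ.+ steps py)                  ≤⟨ ℕₚ.+-mono-≤ x→rx≤ (ℕₚ.+-monoʳ-≤ 2 py≤) ⟩
      dist G (root x) x ℕ.+ (2 ℕ.+ dist G (root y) y)  ∎
    lower : dist G (root x) x ℕ.+ (2 ℕ.+ dist G (root y) y) ≤ dist G x y
    lower with geodesic x y
    ... | q , q≤ with splitAtHub x≢w q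
    ...   | avoids r = ⊥-elim (rx≢ry (attached-unique attached-y (root-attached y≢w)))
      where
      attached-y : attached (root x) y ≡ true
      attached-y = cong₂ _∧_ (root-adj x≢w) (component-complete y≢w (reverse avoid-sym r ◅◅ root-walk x≢w))
    ...   | visits r e rest len = begin
      dist G (root x) x ℕ.+ (2 ℕ.+ dist G (root y) y)   ≤⟨ ℕₚ.+-mono-≤ (dist-root-≤ x≢w r e) (s≤s via-rest) ⟩
      steps r ℕ.+ suc (steps rest)                      ≡⟨ len ⟩
      steps q                                           ≤⟨ q≤ ⟩
      dist G x y                                        ∎
      where
      via-rest : suc (dist G (root y) y) ≤ steps rest
      via-rest = subst (suc (dist G (root y) y) ≤_) (steps-reverse adj-sym rest)
                       (dist-root-< y≢w (reverse adj-sym rest))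

≡ᵇ1-≥2 : ∀ {m} → m ≥ 2 → (m ≡ᵇ 1) ≢ true
≡ᵇ1-≥2 (s≤s (s≤s _)) ()

pendent-≢ : ∀ {n} (G : Graph n) {w x : Fin n} → deg G w ≥ 2 → pendent G x ≡ true → x ≢ w
pendent-≢ G deg≥2 px refl = ≡ᵇ1-≥2 deg≥2 px

module Branches {n : ℕ} (T : Graph n) (connected : Connected T) (acyclic : Acyclic T)
                (w : Fin n) (deg≥2 : deg T w ≥ 2) where

  open Distance T connected using (dist-sym)
  open Hub T connected acyclic w using (root; attached≡root==; dist-through-hub)

  D : Fin n → Fin n → ℤ
  D x y = + dist T x y

  D-cross : ∀ x y → pendent T x ≡ true → pendent T y ≡ true → root x ≢ root y →
            D x y ≡ D (root x) x + (+ 2 + D (root y) y)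
  D-cross x y px py rx≢ry = begin
    + dist T x y
      ≡⟨ cong +_ (dist-through-hub (pendent-≢ T deg≥2 px) (pendent-≢ T deg≥2 py) rx≢ry) ⟩
    + (dist T (root x) x ℕ.+ (2 ℕ.+ dist T (root y) y))
      ≡⟨ ℤ.pos-+ (dist T (root x) x) (2 ℕ.+ dist T (root y) y) ⟩
    D (root x) x + + (2 ℕ.+ dist T (root y) y)
      ≡⟨ cong (_+_ (D (root x) x)) (ℤ.pos-+ 2 (dist T (root y) y)) ⟩
    D (root x) x + (+ 2 + D (root y) y)
      ∎
    where open ≡-Reasoning

  open ClassDecomposition (pendent T) (adj T w) (inComponent T w) root
         (λ x u px → attached≡root== (pendent-≢ T deg≥2 px) u)
         D (λ x y → cong +_ (dist-sym x y)) D-cross public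

  TW-by-branches :
    + TW T ≡ ∑[ u < n ] (𝟙 (adj T w u) * (TWᵢ u + (l - lᵢ u) * d′ᵢ u - lᵢ u * lᵢ u)) + l * l
  TW-by-branches = trans (pairDistSum-∑ T (pendent T)) pairSum-by-classes

theorem3p1 : (n : ℕ) (T : Graph n) → IsTree T → n ≥ 3 →
    (w : Fin n) → deg T w ≥ 2 →
    let l = + count T (pendent T) in
    + TW T ≡
      sumℤ (map (λ u → let lᵤ = + count T (L T w u) in
                  (+ TWcomp T w u) + (l - lᵤ) * (+ d′ T w u) - lᵤ * lᵤ)
                (neighbours T w))
      + l * l
-- n ≥ 3 is implied by deg T w ≥ 2.
theorem3p1 n T (connected , acyclic) _ w deg≥2 = begin
  + TW T
    ≡⟨ TW-by-branches ⟩
  ∑[ u < n ] (𝟙 (adj T w u) * (TWᵢ u + (l - lᵢ u) * d′ᵢ u - lᵢ u * lᵢ u)) + l * l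
    ≡⟨ cong₂ _+_ (sum-cong-≗ λ u → cong (𝟙 (adj T w u) *_) (summand u)) (cong₂ _*_ l≡ l≡) ⟨
  ∑[ u < n ] (𝟙 (adj T w u) * F u) + + count T (pendent T) * + count T (pendent T)
    ≡⟨ cong (_+ _) (sumℤ-filter-allFin (adj T w) F) ⟨
  sumℤ (map F (neighbours T w)) + + count T (pendent T) * + count T (pendent T)
    ∎
  where
  open ≡-Reasoning
  open Branches T connected acyclic w deg≥2

  F : Fin n → ℤ
  F u = + TWcomp T w u + (+ count T (pendent T) - + count T (L T w u)) * + d′ T w u
        - + count T (L T w u) * + count T (L T w u)

  l≡ : + count T (pendent T) ≡ l
  l≡ = count-∑ T (pendent T)

  summand : ∀ u → F u ≡ TWᵢ u + (l - lᵢ u) * d′ᵢ u - lᵢ u * lᵢ u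
  summand u = cong₂ _-_ (cong₂ _+_ (pairDistSum-∑ T (L T w u))
                                   (cong₂ _*_ (cong₂ _-_ l≡ lᵤ≡) (sumOver-∑ T (L T w u) (dist T u))))
                        (cong₂ _*_ lᵤ≡ lᵤ≡)
    where lᵤ≡ = count-∑ T (L T w u)
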